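{- Let $n,m\ge1$ and $1\le r\le n$ be integers, let $\lambda$ be a partition with at most $r$ parts, and let $\mu=(m,m,\dots,m)$ ($r$ parts). Then the sequence $f(\ell)=s_{\lambda+\ell\mu}(x_1,\dots,x_n)$, $\ell\ge0$, satisfies, for all but finitely many $\ell$, a linear recurrence with characteristic polynomial $\prod_{1\le i_1<i_2<\dots<i_r\le n}\bigl(t-(x_{i_1}x_{i_2}\cdots x_{i_r})^m\bigr)$.
   Context: $s_\nu(x_1,\dots,x_n)$ denotes the Schur polynomial of a partition $\nu$ in $n$ variables, viewed in the field $K=\mathbb Q(x_1,\dots,x_n)$. Partitions are added componentwise: $(\lambda+\ell\mu)_i=\lambda_i+\ell\mu_i$. A sequence $f:\mathbb N\to K$ satisfies a linear recurrence with characteristic polynomial $Q(t)=t^D-\alpha_1t^{D-1}+\dots+(-1)^D\alpha_D\in K[t]$ if $f(k+D)-\alpha_1f(k+D-1)+\dots+(-1)^D\alpha_Df(k)=0$ for the relevant $k$. -}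

module Defs where

open import Level using (Level)
open import Algebra.Bundles using (CommutativeRing)
open import Data.Nat using (ℕ; zero; suc; _+_; _∸_; _<?_)
open import Data.Fin using (Fin; zero; suc; toℕ; fromℕ; inject₁)
open import Data.Vec using (Vec; []; _∷_; tabulate; zipWith; lookup)
open import Data.List using (List; []; _∷_; [_]; map; concatMap; upTo; _++_)
open import Data.Bool using (if_then_else_)
open import Relation.Nullary.Decidable using (⌊_⌋)
open import Function using (_∘_)

-- Partitions with at most n parts are encoded as weakly decreasing
-- vectors of length n (padded with zeros).

sumV : ∀ {k} → Vec ℕ k → ℕ
sumV [] = 0
sumV (a ∷ v) = a + sumV v

range : ℕ → ℕ → List ℕ
range b a = map (b +_) (upTo (suc (a ∸ b)))

-- all ν of length k interlacing λ of length k+1: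
-- λ_{i+1} ≤ ν_i ≤ λ_i for all i
interl : ∀ {k} → Vec ℕ (suc k) → List (Vec ℕ k)
interl (a ∷ []) = [ [] ]
interl (a ∷ b ∷ rest) = concatMap (λ c → map (c ∷_) (interl (b ∷ rest))) (range b a)

addScaled : ∀ {k} → Vec ℕ k → ℕ → Vec ℕ k → Vec ℕ k
addScaled λ' ℓ μ = zipWith (λ a b → a + ℓ Data.Nat.* b) λ' μ

rectangle : (n r m : ℕ) → Vec ℕ n
rectangle n r m = tabulate (λ i → if ⌊ toℕ i <? r ⌋ then m else 0)

-- increasing lists (i₁ < ... < i_r) of elements of Fin n, i.e. r-subsets
subsets : (n r : ℕ) → List (List (Fin n))
subsets n zero = [ [] ]
subsets zero (suc r) = []
subsets (suc n) (suc r) =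
  map (zero ∷_) (map (map suc) (subsets n r)) ++ map (map suc) (subsets n (suc r))

module _ {c ℓ : Level} (R : CommutativeRing c ℓ) where
  open CommutativeRing R renaming (_+_ to _⊕_; _*_ to _⊛_)

  sumL : List Carrier → Carrier
  sumL [] = 0#
  sumL (a ∷ as) = a ⊕ sumL as

  pow : Carrier → ℕ → Carrier
  pow a zero = 1#
  pow a (suc k) = a ⊛ pow a k

  -- Schur polynomial s_λ(x₁,…,x_k) evaluated at x, defined by the
  -- branching rule (sum over Gelfand–Tsetlin patterns, i.e. over
  -- semistandard tableaux):
  -- s_λ(x₁..x_k) = Σ_{ν interlacing λ} x_k^{|λ|-|ν|} s_ν(x₁..x_{k-1}),  s_∅() = 1.
  schur : (k : ℕ) → Vec ℕ k → (Fin k → Carrier) → Carrier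
  schur zero [] x = 1#
  schur (suc k) λ' x =
    sumL (map (λ ν → pow (x (fromℕ k)) (sumV λ' ∸ sumV ν) ⊛ schur k ν (x ∘ inject₁))
              (interl λ'))

  mono : ∀ {n} → (Fin n → Carrier) → List (Fin n) → Carrier
  mono x [] = 1#
  mono x (i ∷ is) = x i ⊛ mono x is

  -- univariate polynomials over R as coefficient lists, constant term first
  addP : List Carrier → List Carrier → List Carrier
  addP [] q = q
  addP (a ∷ p) [] = a ∷ p
  addP (a ∷ p) (b ∷ q) = (a ⊕ b) ∷ addP p q

  mulLin : Carrier → List Carrier → List Carrier
  mulLin a p = addP (0# ∷ p) (map (λ b → (- a) ⊛ b) p)

  prodLin : List Carrier → List Carrier
  prodLin [] = 1# ∷ []
  prodLin (y ∷ ys) = mulLin y (prodLin ys)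

  charPoly : (n r m : ℕ) → (Fin n → Carrier) → List Carrier
  charPoly n r m x = prodLin (map (λ S → pow (mono x S) m) (subsets n r))

  recLHS : List Carrier → (ℕ → Carrier) → ℕ → Carrier
  recLHS [] f k = 0#
  recLHS (q ∷ qs) f k = q ⊛ f k ⊕ recLHS qs f (suc k)

  SatisfiesRecFrom : List Carrier → (ℕ → Carrier) → ℕ → Set ℓ
  SatisfiesRecFrom Q f L = ∀ k → L Data.Nat.≤ k → recLHS Q f k ≈ 0#

module Submission where

-- Write Δ_y f (t) = f (t + 1) - y f (t).  A sequence satisfies the
-- recurrence with characteristic polynomial ∏_{y ∈ ys} (t - y) exactly when applying all Δ_y
-- annihilates it (recLHS-prodLin), and this only depends on ys up to permutation (Op-↭).
-- For every partition β with at most k parts and every r ≤ k we show that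
-- u ↦ s_{β + u·(m^r)}(x₁, …, x_k) is annihilated by the roots (x_S)^m, |S| = r (schur-ann),
-- by induction on k.  These roots are the roots not involving x_k together with x_k^m times
-- the roots of size r - 1 (roots-last), while the branching rule writes the Schur polynomial
-- as a sum over interlacing patterns ν weighted by x_k^{|β| - |ν|} (schur-branching).  For
-- fixed values of the unshifted rows, the sum over the last shifted row is a window
-- Σ_{b ≤ j ≤ a + u m} x_k^{a + u m - j} (…): its columns anchored at the top are killed by
-- the first group of roots, its rows anchored at the bottom, twisted by powers of x_k^m, by
-- the second (window-ann); the other shifted rows are peeled off one at a time (Shape.shape).

open import Defs
open import Level using (Level)
open import Algebra.Bundles using (CommutativeRing)
open import Data.Nat using (ℕ; _≤_)
open import Data.Fin using (Fin; toℕ; _≤_)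
open import Data.Vec using (Vec; lookup)
open import Data.Product using (∃)
open import Relation.Binary.PropositionalEquality using (_≡_)

open import Level using (_⊔_)
open import Function using (_∘_; id; mk⇔)
open import Data.Nat as ℕ using (zero; suc; _+_; _*_; _∸_; _<_; z≤n; s≤s)
import Data.Nat.Properties as ℕₚ
open import Data.Fin as Fin using (fromℕ; inject₁)
open import Data.List using (List; []; _∷_; [_]; _++_; map; length; applyUpTo; upTo; concatMap)
import Data.List.Properties as Listₚ
open import Data.List.Relation.Unary.All as All using (All; []; _∷_)
import Data.List.Relation.Unary.All.Properties as Allₚ
open import Data.List.Relation.Binary.Pointwise as Pointwise using (Pointwise; []; _∷_)
import Data.List.Relation.Binary.Permutation.Homogeneous as Perm
import Data.List.Relation.Binary.Permutation.Setoid as Permutation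
import Data.List.Relation.Binary.Permutation.Setoid.Properties as PermutationProperties
open import Data.Vec as Vec using ([]; _∷_)
import Data.Vec.Properties as Vecₚ
open import Data.Product using (_×_; _,_)
open import Data.Unit using (⊤; tt)
open import Data.Bool using (if_then_else_)
open import Data.Maybe using (nothing)
open import Relation.Nullary.Decidable using (⌊_⌋; dec-true; dec-false; does-⇔; isYes≗does)
import Relation.Binary.PropositionalEquality as ≡
import Algebra.Solver.Ring.NaturalCoefficients as NaturalCoefficients
import Algebra.Properties.Ring as RingProperties
import Algebra.Properties.Semiring.Exp as SemiringExp
import Algebra.Properties.CommutativeSemiring.Exp as CommutativeSemiringExp

module Arithmetic where
  open ≡.≡-Reasoning

  within : ∀ {a b i} → b ℕ.≤ a → i ℕ.≤ a ∸ b → b + i ℕ.≤ a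
  within {a} {b} {i} b≤a i≤ = ≡.subst (b + i ℕ.≤_) (ℕₚ.m+[n∸m]≡n b≤a) (ℕₚ.+-monoʳ-≤ b i≤)

  from-top : ∀ {b C i} → b ℕ.≤ C → i ℕ.≤ C ∸ b → b + ((C ∸ b) ∸ i) ≡ C ∸ i
  from-top {b} {C} {i} b≤C i≤ = begin
    b + ((C ∸ b) ∸ i)   ≡⟨ ℕₚ.+-∸-assoc b i≤ ⟨
    (b + (C ∸ b)) ∸ i   ≡⟨ ≡.cong (_∸ i) (ℕₚ.m+[n∸m]≡n b≤C) ⟩
    C ∸ i               ∎

  ray-step : ∀ p s u m → p + (s + u) * m ≡ (p + s * m) + u * m
  ray-step p s u m =
    ≡.trans (≡.cong (p +_) (ℕₚ.*-distribʳ-+ m s u)) (≡.sym (ℕₚ.+-assoc p (s * m) (u * m)))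

  below-top : ∀ {b C i} → b ℕ.≤ C → i ℕ.≤ C ∸ b → b ℕ.≤ C ∸ i
  below-top {b} {C} {i} b≤C i≤ = ≡.subst (ℕ._≤ C ∸ i) (ℕₚ.m∸[m∸n]≡n b≤C) (ℕₚ.∸-monoʳ-≤ C i≤)

  top-step : ∀ a s u m {i} → i ℕ.≤ a + s * m → ((a + s * m) ∸ i) + u * m ≡ (a + (s + u) * m) ∸ i
  top-step a s u m {i} i≤ =
    ≡.trans (≡.sym (ℕₚ.+-∸-comm (u * m) i≤)) (≡.cong (_∸ i) (≡.sym (ray-step a s u m)))

  new-bottom : ∀ b N K i → suc i ℕ.≤ K → ((b + N) + K) ∸ (suc N + i) ≡ b + (K ∸ suc i)
  new-bottom b N K i i<K = begin
    ((b + N) + K) ∸ (suc N + i)   ≡⟨ ≡.cong₂ _∸_ (≡.trans (≡.cong (_+ K) (ℕₚ.+-comm b N)) (ℕₚ.+-assoc N b K))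
                                                   (≡.sym (ℕₚ.+-suc N i)) ⟩
    (N + (b + K)) ∸ (N + suc i)   ≡⟨ ℕₚ.[m+n]∸[m+o]≡n∸o N (b + K) (suc i) ⟩
    (b + K) ∸ suc i               ≡⟨ ℕₚ.+-∸-assoc b i<K ⟩
    b + (K ∸ suc i)               ∎

  -- the exponent |V| - |ν| split at the first row
  split-exponent : ∀ a S b i s → b + i ℕ.≤ a → s ℕ.≤ S →
    (a + S) ∸ ((b + i) + s) ≡ ((a ∸ b) ∸ i) + (S ∸ s)
  split-exponent a S b i s b+i≤a s≤S = begin
    (a + S) ∸ ((b + i) + s)        ≡⟨ ℕₚ.∸-+-assoc (a + S) (b + i) s ⟨
    ((a + S) ∸ (b + i)) ∸ s        ≡⟨ ≡.cong (_∸ s) (ℕₚ.+-∸-comm S b+i≤a) ⟩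
    ((a ∸ (b + i)) + S) ∸ s        ≡⟨ ℕₚ.+-∸-assoc (a ∸ (b + i)) s≤S ⟩
    (a ∸ (b + i)) + (S ∸ s)        ≡⟨ ≡.cong (_+ (S ∸ s)) (ℕₚ.∸-+-assoc a b i) ⟨
    ((a ∸ b) ∸ i) + (S ∸ s)        ∎

  gap-step : ∀ a b t → (a + t) ∸ (b + t) ≡ a ∸ b
  gap-step a b t = ≡.trans (≡.cong₂ _∸_ (ℕₚ.+-comm a t) (ℕₚ.+-comm b t)) (ℕₚ.[m+n]∸[m+o]≡n∸o t a b)

  +-left-comm : ∀ a b d → a + (b + d) ≡ b + (a + d)
  +-left-comm a b d =
    ≡.trans (≡.sym (ℕₚ.+-assoc a b d)) (≡.trans (≡.cong (_+ d) (ℕₚ.+-comm a b)) (ℕₚ.+-assoc b a d))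

  +-right-comm : ∀ a b d → (a + b) + d ≡ (a + d) + b
  +-right-comm a b d =
    ≡.trans (ℕₚ.+-assoc a b d) (≡.trans (≡.cong (a +_) (ℕₚ.+-comm b d)) (≡.sym (ℕₚ.+-assoc a d b)))

module Sequences {c ℓ : Level} (R : CommutativeRing c ℓ) where
  open CommutativeRing R renaming (_+_ to _⊕_; _*_ to _⊛_) hiding (zero)
  open import Relation.Binary.Reasoning.Setoid setoid
  open NaturalCoefficients commutativeSemiring (λ _ _ → nothing) using (solve; _:=_; _:+_; _:*_)
  module Exp = SemiringExp semiring
  open Permutation setoid using (_↭_)
  module ↭ = PermutationProperties setoid

  Seq : Set c
  Seq = ℕ → Carrier

  -- Powers (as in Defs) agree with the library's powers, whose laws we reuse.
  infixr 8 _^_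
  _^_ : Carrier → ℕ → Carrier
  a ^ n = pow R a n

  ^-library : ∀ a n → a ^ n ≈ a Exp.^ n
  ^-library a zero = refl
  ^-library a (suc n) = *-congˡ (^-library a n)

  ^-+ : ∀ a n k → a ^ (n + k) ≈ a ^ n ⊛ a ^ k
  ^-+ a n k = begin
    a ^ (n + k)             ≈⟨ ^-library a (n + k) ⟩
    a Exp.^ (n + k)         ≈⟨ Exp.^-homo-* a n k ⟩
    a Exp.^ n ⊛ a Exp.^ k   ≈⟨ *-cong (^-library a n) (^-library a k) ⟨
    a ^ n ⊛ a ^ k           ∎

  ^-* : ∀ a n k → (a ^ n) ^ k ≈ a ^ (k * n)
  ^-* a n k = begin
    (a ^ n) ^ k             ≈⟨ ^-library (a ^ n) k ⟩
    (a ^ n) Exp.^ k         ≈⟨ Exp.^-congˡ k (^-library a n) ⟩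
    (a Exp.^ n) Exp.^ k     ≈⟨ Exp.^-assocʳ a n k ⟩
    a Exp.^ (n * k)         ≡⟨ ≡.cong (a Exp.^_) (ℕₚ.*-comm n k) ⟩
    a Exp.^ (k * n)         ≈⟨ ^-library a (k * n) ⟨
    a ^ (k * n)             ∎

  ^-distrib : ∀ a b n → (a ⊛ b) ^ n ≈ a ^ n ⊛ b ^ n
  ^-distrib a b n = begin
    (a ⊛ b) ^ n             ≈⟨ ^-library (a ⊛ b) n ⟩
    (a ⊛ b) Exp.^ n         ≈⟨ CommutativeSemiringExp.^-distrib-* commutativeSemiring a b n ⟩
    a Exp.^ n ⊛ b Exp.^ n   ≈⟨ *-cong (^-library a n) (^-library b n) ⟨
    a ^ n ⊛ b ^ n           ∎

  ^-congˡ : ∀ n {a b} → a ≈ b → a ^ n ≈ b ^ n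
  ^-congˡ n a≈b = trans (^-library _ n) (trans (Exp.^-congˡ n a≈b) (sym (^-library _ n)))

  1^ : ∀ n → 1# ^ n ≈ 1#
  1^ zero = refl
  1^ (suc n) = trans (*-identityˡ _) (1^ n)

  ∑ : ℕ → (ℕ → Carrier) → Carrier
  ∑ zero f = 0#
  ∑ (suc n) f = f 0 ⊕ ∑ n (λ i → f (suc i))

  -- Finite sums, the action of a polynomial on a sequence, and the difference operators
  -- below are all of this kind, and such functionals may be pushed through one another.
  record IsLinear {I : Set} (Φ : (I → Carrier) → Carrier) : Set (c ⊔ ℓ) where
    field
      cong  : ∀ {f g} → (∀ i → f i ≈ g i) → Φ f ≈ Φ g
      +-hom : ∀ f g → Φ (λ i → f i ⊕ g i) ≈ Φ f ⊕ Φ g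
      *-hom : ∀ a f → Φ (λ i → a ⊛ f i) ≈ a ⊛ Φ f

    vanish : ∀ {f} → (∀ i → f i ≈ 0#) → Φ f ≈ 0#
    vanish {f} f≈0 = begin
      Φ f                 ≈⟨ cong (λ i → trans (f≈0 i) (sym (zeroˡ 0#))) ⟩
      Φ (λ _ → 0# ⊛ 0#)   ≈⟨ *-hom 0# (λ _ → 0#) ⟩
      0# ⊛ Φ (λ _ → 0#)   ≈⟨ zeroˡ _ ⟩
      0#                  ∎

    ∑-comm : ∀ n (F : ℕ → I → Carrier) → Φ (λ i → ∑ n (λ j → F j i)) ≈ ∑ n (λ j → Φ (F j))
    ∑-comm zero F = vanish (λ _ → refl)
    ∑-comm (suc n) F = trans (+-hom _ _) (+-congˡ (∑-comm n (λ j → F (suc j))))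

    recLHS-comm : ∀ q (F : ℕ → I → Carrier) t →
      Φ (λ i → recLHS R q (λ k → F k i) t) ≈ recLHS R q (λ k → Φ (F k)) t
    recLHS-comm [] F t = vanish (λ _ → refl)
    recLHS-comm (q ∷ qs) F t = trans (+-hom _ _) (+-cong (*-hom q (F t)) (recLHS-comm qs F (suc t)))

  interchange : ∀ a b a' b' → (a ⊕ b) ⊕ (a' ⊕ b') ≈ (a ⊕ a') ⊕ (b ⊕ b')
  interchange = solve 4 (λ a b a' b' → (a :+ b) :+ (a' :+ b') := (a :+ a') :+ (b :+ b')) refl

  *-left-comm : ∀ a b d → a ⊛ (b ⊛ d) ≈ b ⊛ (a ⊛ d)
  *-left-comm = solve 3 (λ a b d → a :* (b :* d) := b :* (a :* d)) refl

  ∑-cong : ∀ n {f g} → (∀ i → i < n → f i ≈ g i) → ∑ n f ≈ ∑ n g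
  ∑-cong zero e = refl
  ∑-cong (suc n) e = +-cong (e 0 (s≤s z≤n)) (∑-cong n (λ i i<n → e (suc i) (s≤s i<n)))

  ∑-linear : ∀ n → IsLinear (∑ n)
  ∑-linear n = record { cong = λ e → ∑-cong n (λ i _ → e i) ; +-hom = ∑-+ n ; *-hom = ∑-* n }
    where
    ∑-+ : ∀ n f g → ∑ n (λ i → f i ⊕ g i) ≈ ∑ n f ⊕ ∑ n g
    ∑-+ zero f g = sym (+-identityˡ 0#)
    ∑-+ (suc n) f g = trans (+-congˡ (∑-+ n _ _)) (interchange _ _ _ _)
    ∑-* : ∀ n a f → ∑ n (λ i → a ⊛ f i) ≈ a ⊛ ∑ n f
    ∑-* zero a f = sym (zeroʳ a)
    ∑-* (suc n) a f = trans (+-congˡ (∑-* n a _)) (sym (distribˡ a _ _))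

  ∑-vanish : ∀ n {f} → (∀ i → i < n → f i ≈ 0#) → ∑ n f ≈ 0#
  ∑-vanish n e = trans (∑-cong n e) (IsLinear.vanish (∑-linear n) (λ _ → refl))

  ∑-split : ∀ n k f → ∑ (n + k) f ≈ ∑ n f ⊕ ∑ k (λ i → f (n + i))
  ∑-split zero k f = sym (+-identityˡ _)
  ∑-split (suc n) k f = trans (+-congˡ (∑-split n k _)) (sym (+-assoc _ _ _))

  ∑-last : ∀ n f → ∑ (suc n) f ≈ ∑ n f ⊕ f n
  ∑-last zero f = trans (+-identityʳ _) (sym (+-identityˡ _))
  ∑-last (suc n) f = trans (+-congˡ (∑-last n _)) (sym (+-assoc _ _ _))

  ∑-reverse : ∀ n f → ∑ n f ≈ ∑ n (λ i → f (n ∸ suc i))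
  ∑-reverse zero f = refl
  ∑-reverse (suc n) f = begin
    f 0 ⊕ ∑ n (λ i → f (suc i))           ≈⟨ +-congˡ (∑-reverse n _) ⟩
    f 0 ⊕ ∑ n (λ i → f (suc (n ∸ suc i))) ≈⟨ +-congˡ (∑-cong n (λ i i<n →
                                               reflexive (≡.cong f (≡.sym (ℕₚ.+-∸-assoc 1 i<n))))) ⟩
    f 0 ⊕ ∑ n (λ i → f (n ∸ i))           ≈⟨ +-comm _ _ ⟩
    ∑ n (λ i → f (n ∸ i)) ⊕ f 0           ≡⟨ ≡.cong (λ j → ∑ n (λ i → f (n ∸ i)) ⊕ f j) (ℕₚ.n∸n≡0 n) ⟨
    ∑ n (λ i → f (n ∸ i)) ⊕ f (n ∸ n)     ≈⟨ ∑-last n _ ⟨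
    ∑ (suc n) (λ i → f (n ∸ i))           ∎

  -- Δ y acts on sequences as multiplication by (t - y) acts on polynomials,
  -- and Op ys as multiplication by ∏_{y ∈ ys} (t - y).
  Δ : Carrier → Seq → Seq
  Δ y f t = f (suc t) ⊕ (- y) ⊛ f t

  Op : List Carrier → Seq → Seq
  Op [] f = f
  Op (y ∷ ys) f = Op ys (Δ y f)

  Op-linear : ∀ ys t → IsLinear (λ f → Op ys f t)
  Op-linear [] t = record { cong = λ e → e t ; +-hom = λ _ _ → refl ; *-hom = λ _ _ → refl }
  Op-linear (y ∷ ys) t = record
    { cong  = λ e → cong (λ u → +-cong (e (suc u)) (*-congˡ (e u)))
    ; +-hom = λ f g → trans (cong (λ u → Δ-+ (f (suc u)) (g (suc u)) (f u) (g u) (- y))) (+-hom _ _)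
    ; *-hom = λ a f → trans (cong (λ u → Δ-* a (f (suc u)) (f u) (- y))) (*-hom a _)
    }
    where
    open IsLinear (Op-linear ys t)
    Δ-+ : ∀ a b a' b' z → (a ⊕ b) ⊕ z ⊛ (a' ⊕ b') ≈ (a ⊕ z ⊛ a') ⊕ (b ⊕ z ⊛ b')
    Δ-+ = solve 5 (λ a b a' b' z → (a :+ b) :+ z :* (a' :+ b') := (a :+ z :* a') :+ (b :+ z :* b')) refl
    Δ-* : ∀ a b b' z → a ⊛ b ⊕ z ⊛ (a ⊛ b') ≈ a ⊛ (b ⊕ z ⊛ b')
    Δ-* = solve 4 (λ a b b' z → a :* b :+ z :* (a :* b') := a :* (b :+ z :* b')) refl

  Op-cong : ∀ ys t {f g} → (∀ u → f u ≈ g u) → Op ys f t ≈ Op ys g t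
  Op-cong ys t = IsLinear.cong (Op-linear ys t)

  Op-++ : ∀ ys zs f t → Op (ys ++ zs) f t ≡ Op zs (Op ys f) t
  Op-++ [] zs f t = ≡.refl
  Op-++ (y ∷ ys) zs f t = Op-++ ys zs (Δ y f) t

  Δ-cong : ∀ {y z f g} → y ≈ z → (∀ u → f u ≈ g u) → ∀ u → Δ y f u ≈ Δ z g u
  Δ-cong y≈z f≈g u = +-cong (f≈g (suc u)) (*-cong (-‿cong y≈z) (f≈g u))

  -- Difference operators commute, so Op ys only depends on ys up to permutation.
  Δ-comm : ∀ y z f u → Δ y (Δ z f) u ≈ Δ z (Δ y f) u
  Δ-comm y z f u = lemma (f (suc (suc u))) (f (suc u)) (f u) (- y) (- z)
    where
    lemma : ∀ a b d p q → (a ⊕ q ⊛ b) ⊕ p ⊛ (b ⊕ q ⊛ d) ≈ (a ⊕ p ⊛ b) ⊕ q ⊛ (b ⊕ p ⊛ d)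
    lemma = solve 5 (λ a b d p q → (a :+ q :* b) :+ p :* (b :+ q :* d)
                                  := (a :+ p :* b) :+ q :* (b :+ p :* d)) refl

  Op-≋ : ∀ {ys zs} → Pointwise _≈_ ys zs → ∀ f t → Op ys f t ≈ Op zs f t
  Op-≋ [] f t = refl
  Op-≋ {y ∷ ys} (y≈z ∷ ys≋zs) f t =
    trans (Op-cong ys t (Δ-cong y≈z (λ _ → refl))) (Op-≋ ys≋zs _ t)

  Op-↭ : ∀ {ys zs} → ys ↭ zs → ∀ f t → Op ys f t ≈ Op zs f t
  Op-↭ (Perm.refl ys≋zs) f t = Op-≋ ys≋zs f t
  Op-↭ (Perm.prep {ys} y≈z p) f t =
    trans (Op-cong ys t (Δ-cong y≈z (λ _ → refl))) (Op-↭ p _ t)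
  Op-↭ (Perm.swap {ys} {x = y} {y = z} y≈y' z≈z' p) f t =
    trans (Op-cong ys t (λ u → trans (Δ-comm z y f u) (Δ-cong y≈y' (Δ-cong {f = f} {g = f} z≈z' (λ _ → refl)) u)))
      (Op-↭ p _ t)
  Op-↭ (Perm.trans p q) f t = trans (Op-↭ p f t) (Op-↭ q f t)

  -- ys annihilates f: the sequence f satisfies the recurrence ∏_{y ∈ ys} (t - y).
  Ann : List Carrier → Seq → Set ℓ
  Ann ys f = ∀ t → Op ys f t ≈ 0#

  Ann-cong : ∀ ys {f g} → (∀ u → f u ≈ g u) → Ann ys g → Ann ys f
  Ann-cong ys f≈g ann t = trans (Op-cong ys t f≈g) (ann t)

  Ann-++ : ∀ ys zs {f} → Ann zs f → Ann (ys ++ zs) f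
  Ann-++ ys zs {f} ann t = begin
    Op (ys ++ zs) f t   ≈⟨ Op-↭ (↭.++-comm ys zs) f t ⟩
    Op (zs ++ ys) f t   ≡⟨ Op-++ zs ys f t ⟩
    Op ys (Op zs f) t   ≈⟨ IsLinear.vanish (Op-linear ys t) ann ⟩
    0#                  ∎

  Ann-scale : ∀ ys a {f} → Ann ys f → Ann ys (λ u → a ⊛ f u)
  Ann-scale ys a ann t = trans (IsLinear.*-hom (Op-linear ys t) a _) (trans (*-congˡ (ann t)) (zeroʳ a))

  Op-twist : ∀ ys a g t → Op (map (a ⊛_) ys) (λ s → a ^ s ⊛ g s) t ≈ a ^ t ⊛ (a ^ length ys ⊛ Op ys g t)
  Op-twist [] a g t = *-congˡ (sym (*-identityˡ _))
  Op-twist (y ∷ ys) a g t = begin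
    Op (map (a ⊛_) ys) (Δ (a ⊛ y) (λ s → a ^ s ⊛ g s)) t
      ≈⟨ Op-cong (map (a ⊛_) ys) t (λ s → Δ-twist (a ^ s) (g (suc s)) (g s)) ⟩
    Op (map (a ⊛_) ys) (λ s → a ^ s ⊛ (a ⊛ Δ y g s)) t
      ≈⟨ Op-twist ys a _ t ⟩
    a ^ t ⊛ (a ^ length ys ⊛ Op ys (λ s → a ⊛ Δ y g s) t)
      ≈⟨ *-congˡ (*-congˡ (IsLinear.*-hom (Op-linear ys t) a _)) ⟩
    a ^ t ⊛ (a ^ length ys ⊛ (a ⊛ Op ys (Δ y g) t))
      ≈⟨ *-congˡ (sym (trans (*-assoc _ _ _) (*-left-comm a _ _))) ⟩
    a ^ t ⊛ (a ^ suc (length ys) ⊛ Op ys (Δ y g) t)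
      ∎
    where
    twist : ∀ a p b d z → (a ⊛ p) ⊛ b ⊕ (a ⊛ z) ⊛ (p ⊛ d) ≈ p ⊛ (a ⊛ (b ⊕ z ⊛ d))
    twist = solve 5 (λ a p b d z → (a :* p) :* b :+ (a :* z) :* (p :* d) := p :* (a :* (b :+ z :* d))) refl
    Δ-twist : ∀ p b d → (a ⊛ p) ⊛ b ⊕ (- (a ⊛ y)) ⊛ (p ⊛ d) ≈ p ⊛ (a ⊛ (b ⊕ (- y) ⊛ d))
    Δ-twist p b d = trans (+-congˡ (*-congʳ (RingProperties.-‿distribʳ-* ring a y))) (twist a p b d (- y))

  Ann-twist : ∀ ys a {g} → Ann ys g → Ann (map (a ⊛_) ys) (λ s → a ^ s ⊛ g s)
  Ann-twist ys a ann t =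
    trans (Op-twist ys a _ t) (trans (*-congˡ (trans (*-congˡ (ann t)) (zeroʳ _))) (zeroʳ _))

  recLHS-cong : ∀ q t {f g} → (∀ u → f u ≈ g u) → recLHS R q f t ≈ recLHS R q g t
  recLHS-cong [] t e = refl
  recLHS-cong (q ∷ qs) t e = +-cong (*-congˡ (e t)) (recLHS-cong qs (suc t) e)

  recLHS-linear : ∀ q t → IsLinear (λ f → recLHS R q f t)
  recLHS-linear q t = record { cong = λ e → recLHS-cong q t e ; +-hom = rec-+ q t ; *-hom = rec-* q t }
    where
    rec-+ : ∀ q t f g → recLHS R q (λ u → f u ⊕ g u) t ≈ recLHS R q f t ⊕ recLHS R q g t
    rec-+ [] t f g = sym (+-identityˡ 0#)
    rec-+ (q ∷ qs) t f g = trans (+-cong (distribˡ q _ _) (rec-+ qs (suc t) f g)) (interchange _ _ _ _)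
    rec-* : ∀ q t a f → recLHS R q (λ u → a ⊛ f u) t ≈ a ⊛ recLHS R q f t
    rec-* [] t a f = sym (zeroʳ a)
    rec-* (q ∷ qs) t a f = trans (+-cong (*-left-comm q a _) (rec-* qs (suc t) a f)) (sym (distribˡ a _ _))

  recLHS-shift : ∀ q f s t → recLHS R q f (s + t) ≈ recLHS R q (λ u → f (s + u)) t
  recLHS-shift [] f s t = refl
  recLHS-shift (q ∷ qs) f s t =
    +-congˡ (trans (reflexive (≡.cong (recLHS R qs f) (≡.sym (ℕₚ.+-suc s t)))) (recLHS-shift qs f s (suc t)))

  recLHS-prodLin : ∀ ys f t → recLHS R (prodLin R ys) f t ≈ Op ys f t
  recLHS-prodLin [] f t = trans (+-identityʳ _) (*-identityˡ _)
  recLHS-prodLin (y ∷ ys) f t = trans (recLHS-mulLin (prodLin R ys) t) (recLHS-prodLin ys (Δ y f) t)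
    where
    recLHS-addP : ∀ p q t → recLHS R (addP R p q) f t ≈ recLHS R p f t ⊕ recLHS R q f t
    recLHS-addP [] q t = sym (+-identityˡ _)
    recLHS-addP (a ∷ p) [] t = sym (+-identityʳ _)
    recLHS-addP (a ∷ p) (b ∷ q) t =
      trans (+-cong (distribʳ (f t) a b) (recLHS-addP p q (suc t))) (interchange _ _ _ _)
    recLHS-scaled : ∀ a p t → recLHS R (map (a ⊛_) p) f t ≈ recLHS R p (λ u → a ⊛ f u) t
    recLHS-scaled a [] t = refl
    recLHS-scaled a (q ∷ p) t = +-cong (trans (*-assoc a q _) (*-left-comm a q _)) (recLHS-scaled a p (suc t))
    recLHS-mulLin : ∀ p t → recLHS R (mulLin R y p) f t ≈ recLHS R p (Δ y f) t
    recLHS-mulLin p t = begin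
      recLHS R (addP R (0# ∷ p) (map ((- y) ⊛_) p)) f t
        ≈⟨ recLHS-addP (0# ∷ p) (map ((- y) ⊛_) p) t ⟩
      (0# ⊛ f t ⊕ recLHS R p f (suc t)) ⊕ recLHS R (map ((- y) ⊛_) p) f t
        ≈⟨ +-cong (trans (+-congʳ (zeroˡ _)) (+-identityˡ _)) (recLHS-scaled (- y) p t) ⟩
      recLHS R p f (1 + t) ⊕ recLHS R p (λ u → (- y) ⊛ f u) t
        ≈⟨ +-congʳ (recLHS-shift p f 1 t) ⟩
      recLHS R p (λ u → f (suc u)) t ⊕ recLHS R p (λ u → (- y) ⊛ f u) t
        ≈⟨ IsLinear.+-hom (recLHS-linear p t) _ _ ⟨
      recLHS R p (Δ y f) t
        ∎

module Roots {c ℓ : Level} (R : CommutativeRing c ℓ) where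
  open CommutativeRing R renaming (_+_ to _⊕_; _*_ to _⊛_) hiding (zero)
  open Sequences R using (_^_; ^-congˡ; ^-distrib; *-left-comm)
  open Permutation setoid using (_↭_; ↭-reflexive; module PermutationReasoning)
  module ↭ = PermutationProperties setoid

  monomials : (n r : ℕ) → (Fin n → Carrier) → List Carrier
  monomials n r x = map (mono R x) (subsets n r)

  -- `subsets` is built by deciding membership of the first index.
  monomials-first : ∀ N r (x : Fin (suc N) → Carrier) →
    monomials (suc N) (suc r) x
      ≡ map (x Fin.zero ⊛_) (monomials N r (x ∘ Fin.suc)) ++ monomials N (suc r) (x ∘ Fin.suc)
  monomials-first N r x =
    ≡.trans (Listₚ.map-++ (mono R x) (map (Fin.zero ∷_) (map (map Fin.suc) (subsets N r))) _)
            (≡.cong₂ _++_ (with-first (subsets N r)) (without-first (subsets N (suc r))))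
    where
    mono-suc : ∀ S → mono R x (map Fin.suc S) ≡ mono R (x ∘ Fin.suc) S
    mono-suc [] = ≡.refl
    mono-suc (i ∷ S) = ≡.cong (x (Fin.suc i) ⊛_) (mono-suc S)
    with-first : ∀ L → map (mono R x) (map (Fin.zero ∷_) (map (map Fin.suc) L))
                         ≡ map (x Fin.zero ⊛_) (map (mono R (x ∘ Fin.suc)) L)
    with-first [] = ≡.refl
    with-first (S ∷ L) = ≡.cong₂ _∷_ (≡.cong (x Fin.zero ⊛_) (mono-suc S)) (with-first L)
    without-first : ∀ L → map (mono R x) (map (map Fin.suc) L) ≡ map (mono R (x ∘ Fin.suc)) L
    without-first [] = ≡.refl
    without-first (S ∷ L) = ≡.cong₂ _∷_ (mono-suc S) (without-first L)

  monomials-none : ∀ r (y y' : Fin 0 → Carrier) → monomials 0 r y ≡ monomials 0 r y'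
  monomials-none zero y y' = ≡.refl
  monomials-none (suc r) y y' = ≡.refl

  monomials-last : ∀ N r (x : Fin (suc N) → Carrier) →
    monomials (suc N) (suc r) x
      ↭ map (x (fromℕ N) ⊛_) (monomials N r (x ∘ inject₁)) ++ monomials N (suc r) (x ∘ inject₁)
  monomials-last zero r x = ↭-reflexive (≡.trans (monomials-first zero r x)
    (≡.cong₂ (λ A B → map (x Fin.zero ⊛_) A ++ B) (monomials-none r (x ∘ Fin.suc) (x ∘ inject₁))
                                                 (monomials-none (suc r) (x ∘ Fin.suc) (x ∘ inject₁))))
  monomials-last (suc N) zero x = begin
    monomials (suc (suc N)) 1 x
      ≡⟨ monomials-first (suc N) zero x ⟩
    [ x₀ ⊛ 1# ] ++ monomials (suc N) 1 (x ∘ Fin.suc)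
      ↭⟨ ↭.++⁺ˡ [ x₀ ⊛ 1# ] (monomials-last N zero (x ∘ Fin.suc)) ⟩
    [ x₀ ⊛ 1# ] ++ [ xₗ ⊛ 1# ] ++ monomials N 1 z
      ↭⟨ ↭.shifts [ x₀ ⊛ 1# ] [ xₗ ⊛ 1# ] ⟩
    [ xₗ ⊛ 1# ] ++ [ x₀ ⊛ 1# ] ++ monomials N 1 z
      ≡⟨ ≡.cong ([ xₗ ⊛ 1# ] ++_) (monomials-first N zero (x ∘ inject₁)) ⟨
    [ xₗ ⊛ 1# ] ++ monomials (suc N) 1 (x ∘ inject₁)
      ∎
    where
    open PermutationReasoning
    x₀ : Carrier
    x₀ = x Fin.zero
    xₗ : Carrier
    xₗ = x (fromℕ (suc N))
    z : Fin N → Carrier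
    z = x ∘ Fin.suc ∘ inject₁
  monomials-last (suc N) (suc r) x = begin
    monomials (suc (suc N)) (suc (suc r)) x
      ≡⟨ monomials-first (suc N) (suc r) x ⟩
    map (x₀ ⊛_) (monomials (suc N) (suc r) (x ∘ Fin.suc)) ++ monomials (suc N) (suc (suc r)) (x ∘ Fin.suc)
      ↭⟨ ↭.++⁺ (↭.map⁺ setoid *-congˡ (monomials-last N r (x ∘ Fin.suc)))
              (monomials-last N (suc r) (x ∘ Fin.suc)) ⟩
    map (x₀ ⊛_) (map (xₗ ⊛_) M₁ ++ M₂) ++ (map (xₗ ⊛_) M₂ ++ M₃)
      ≡⟨ ≡.cong (_++ (map (xₗ ⊛_) M₂ ++ M₃)) (Listₚ.map-++ (x₀ ⊛_) (map (xₗ ⊛_) M₁) M₂) ⟩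
    (map (x₀ ⊛_) (map (xₗ ⊛_) M₁) ++ map (x₀ ⊛_) M₂) ++ (map (xₗ ⊛_) M₂ ++ M₃)
      ↭⟨ middle-swap (map (x₀ ⊛_) (map (xₗ ⊛_) M₁)) (map (x₀ ⊛_) M₂) (map (xₗ ⊛_) M₂) M₃ ⟩
    (map (x₀ ⊛_) (map (xₗ ⊛_) M₁) ++ map (xₗ ⊛_) M₂) ++ (map (x₀ ⊛_) M₂ ++ M₃)
      ≋⟨ Pointwise.++⁺ (Pointwise.++⁺ (swap-factors M₁) (Pointwise.refl refl)) (Pointwise.refl refl) ⟩
    (map (xₗ ⊛_) (map (x₀ ⊛_) M₁) ++ map (xₗ ⊛_) M₂) ++ (map (x₀ ⊛_) M₂ ++ M₃)
      ≡⟨ ≡.cong₂ _++_ (≡.trans (≡.sym (Listₚ.map-++ (xₗ ⊛_) (map (x₀ ⊛_) M₁) M₂))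
                                (≡.cong (map (xₗ ⊛_)) (≡.sym (monomials-first N r (x ∘ inject₁)))))
                      (≡.sym (monomials-first N (suc r) (x ∘ inject₁))) ⟩
    map (xₗ ⊛_) (monomials (suc N) (suc r) (x ∘ inject₁)) ++ monomials (suc N) (suc (suc r)) (x ∘ inject₁)
      ∎
    where
    open PermutationReasoning
    x₀ : Carrier
    x₀ = x Fin.zero
    xₗ : Carrier
    xₗ = x (fromℕ (suc N))
    z : Fin N → Carrier
    z = x ∘ Fin.suc ∘ inject₁
    M₁ : List Carrier
    M₁ = monomials N r z
    M₂ : List Carrier
    M₂ = monomials N (suc r) z
    M₃ : List Carrier
    M₃ = monomials N (suc (suc r)) z
    middle-swap : ∀ A B C D → (A ++ B) ++ (C ++ D) ↭ (A ++ C) ++ (B ++ D)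
    middle-swap A B C D = begin
      (A ++ B) ++ (C ++ D)   ≡⟨ Listₚ.++-assoc A B (C ++ D) ⟩
      A ++ (B ++ (C ++ D))   ↭⟨ ↭.++⁺ˡ A (↭.shifts B C) ⟩
      A ++ (C ++ (B ++ D))   ≡⟨ Listₚ.++-assoc A C (B ++ D) ⟨
      (A ++ C) ++ (B ++ D)   ∎
    swap-factors : ∀ L → Pointwise _≈_ (map (x₀ ⊛_) (map (xₗ ⊛_) L)) (map (xₗ ⊛_) (map (x₀ ⊛_) L))
    swap-factors [] = []
    swap-factors (u ∷ L) = *-left-comm x₀ xₗ u ∷ swap-factors L

  roots : (n r m : ℕ) → (Fin n → Carrier) → List Carrier
  roots n r m x = map (λ S → mono R x S ^ m) (subsets n r)

  roots-last : ∀ N r m (x : Fin (suc N) → Carrier) →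
    roots (suc N) (suc r) m x
      ↭ roots N (suc r) m (x ∘ inject₁) ++ map ((x (fromℕ N) ^ m) ⊛_) (roots N r m (x ∘ inject₁))
  roots-last N r m x = begin
    roots (suc N) (suc r) m x
      ≡⟨ Listₚ.map-∘ (subsets (suc N) (suc r)) ⟩
    map (_^ m) (monomials (suc N) (suc r) x)
      ↭⟨ ↭.map⁺ setoid (^-congˡ m) (monomials-last N r x) ⟩
    map (_^ m) (map (xₗ ⊛_) M₁ ++ M₂)
      ≡⟨ Listₚ.map-++ (_^ m) (map (xₗ ⊛_) M₁) M₂ ⟩
    map (_^ m) (map (xₗ ⊛_) M₁) ++ map (_^ m) M₂
      ≋⟨ Pointwise.++⁺ (distribute M₁) (Pointwise.refl refl) ⟩
    map ((xₗ ^ m) ⊛_) (map (_^ m) M₁) ++ map (_^ m) M₂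
      ↭⟨ ↭.++-comm (map ((xₗ ^ m) ⊛_) (map (_^ m) M₁)) (map (_^ m) M₂) ⟩
    map (_^ m) M₂ ++ map ((xₗ ^ m) ⊛_) (map (_^ m) M₁)
      ≡⟨ ≡.cong₂ (λ A B → A ++ map ((xₗ ^ m) ⊛_) B)
                  (Listₚ.map-∘ (subsets N (suc r))) (Listₚ.map-∘ (subsets N r)) ⟨
    roots N (suc r) m (x ∘ inject₁) ++ map ((xₗ ^ m) ⊛_) (roots N r m (x ∘ inject₁))
      ∎
    where
    open PermutationReasoning
    xₗ : Carrier
    xₗ = x (fromℕ N)
    M₁ : List Carrier
    M₁ = monomials N r (x ∘ inject₁)
    M₂ : List Carrier
    M₂ = monomials N (suc r) (x ∘ inject₁)
    distribute : ∀ L → Pointwise _≈_ (map (_^ m) (map (xₗ ⊛_) L)) (map ((xₗ ^ m) ⊛_) (map (_^ m) L))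
    distribute [] = []
    distribute (u ∷ L) = ^-distrib xₗ u m ∷ distribute L

module Partitions where

  headLe : ∀ {k} → Vec ℕ k → ℕ → Set
  headLe [] n = ⊤
  headLe (b ∷ w) n = b ℕ.≤ n

  Part : ∀ {k} → Vec ℕ k → Set
  Part [] = ⊤
  Part (a ∷ w) = headLe w a × Part w

  headLe-mono : ∀ {k} (w : Vec ℕ k) {a b} → a ℕ.≤ b → headLe w a → headLe w b
  headLe-mono [] a≤b h = tt
  headLe-mono (_ ∷ w) a≤b h = ℕₚ.≤-trans h a≤b

  Interl : ∀ {k} → Vec ℕ (suc k) → Vec ℕ k → Set
  Interl (a ∷ []) [] = ⊤
  Interl (a ∷ b ∷ w) (c' ∷ ν) = b ℕ.≤ c' × c' ℕ.≤ a × Interl (b ∷ w) ν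

  interl-head : ∀ {k} (V : Vec ℕ (suc k)) ν → Interl V ν → headLe ν (Vec.head V)
  interl-head (a ∷ []) [] _ = tt
  interl-head (a ∷ b ∷ w) (c' ∷ ν) (_ , c'≤a , _) = c'≤a

  interl-part : ∀ {k} (V : Vec ℕ (suc k)) ν → Part V → Interl V ν → Part ν
  interl-part (a ∷ []) [] _ _ = tt
  interl-part (a ∷ b ∷ w) (c' ∷ ν) (_ , pV) (b≤c' , _ , int) =
    headLe-mono ν b≤c' (interl-head (b ∷ w) ν int) , interl-part (b ∷ w) ν pV int

  Part-addScaled : ∀ {n} (β ρ : Vec ℕ n) u → Part β → Part ρ → Part (addScaled β u ρ)
  Part-addScaled [] [] u _ _ = tt
  Part-addScaled (a ∷ []) (p ∷ []) u _ _ = tt , tt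
  Part-addScaled (a ∷ b ∷ β) (p ∷ q ∷ ρ) u (b≤a , pβ) (q≤p , pρ) =
    ℕₚ.+-mono-≤ b≤a (ℕₚ.*-monoʳ-≤ u q≤p) , Part-addScaled (b ∷ β) (q ∷ ρ) u pβ pρ

  Part-of : ∀ {n} (v : Vec ℕ n) → (∀ (i j : Fin n) → i Fin.≤ j → lookup v j ℕ.≤ lookup v i) → Part v
  Part-of [] _ = tt
  Part-of (a ∷ []) _ = tt , tt
  Part-of (a ∷ b ∷ v) h =
    h Fin.zero (Fin.suc Fin.zero) z≤n , Part-of (b ∷ v) (λ i j i≤j → h (Fin.suc i) (Fin.suc j) (s≤s i≤j))

module Rectangles (m : ℕ) where
  open Partitions

  rect : (n r : ℕ) → Vec ℕ n
  rect zero r = []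
  rect (suc n) zero = 0 ∷ rect n zero
  rect (suc n) (suc r) = m ∷ rect n r

  rectangle≡rect : ∀ n r → rectangle n r m ≡ rect n r
  rectangle≡rect zero r = ≡.refl
  rectangle≡rect (suc n) zero = ≡.cong₂ _∷_ (outside 0)
    (≡.trans (Vecₚ.tabulate-cong (λ i → ≡.trans (outside (suc (toℕ i))) (≡.sym (outside (toℕ i)))))
             (rectangle≡rect n zero))
    where
    outside : ∀ i → (if ⌊ i ℕₚ.<? 0 ⌋ then m else 0) ≡ 0
    outside i = ≡.cong (if_then m else 0) (dec-false (i ℕₚ.<? 0) ℕₚ.n≮0)
  rectangle≡rect (suc n) (suc r) = ≡.cong₂ _∷_ (≡.cong (if_then m else 0) (dec-true (0 ℕₚ.<? suc r) (s≤s z≤n)))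
    (≡.trans (Vecₚ.tabulate-cong (λ i → ≡.cong (if_then m else 0) (shift (toℕ i)))) (rectangle≡rect n r))
    where
    shift : ∀ i → ⌊ suc i ℕₚ.<? suc r ⌋ ≡ ⌊ i ℕₚ.<? r ⌋
    shift i = ≡.trans (isYes≗does (suc i ℕₚ.<? suc r))
      (≡.trans (does-⇔ (mk⇔ ℕₚ.≤-pred s≤s) (suc i ℕₚ.<? suc r) (i ℕₚ.<? r)) (≡.sym (isYes≗does (i ℕₚ.<? r))))

  addScaled-flat : ∀ {n} (β : Vec ℕ n) u → addScaled β u (rect n zero) ≡ β
  addScaled-flat [] u = ≡.refl
  addScaled-flat (a ∷ β) u =
    ≡.cong₂ _∷_ (≡.trans (≡.cong (a +_) (ℕₚ.*-zeroʳ u)) (ℕₚ.+-identityʳ a)) (addScaled-flat β u)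

  Part-rect : ∀ n r → Part (rect n r)
  Part-rect zero r = tt
  Part-rect (suc zero) zero = tt , tt
  Part-rect (suc zero) (suc r) = tt , tt
  Part-rect (suc (suc n)) zero = z≤n , Part-rect (suc n) zero
  Part-rect (suc (suc n)) (suc zero) = z≤n , Part-rect (suc n) zero
  Part-rect (suc (suc n)) (suc (suc r)) = ℕₚ.≤-refl , Part-rect (suc n) (suc r)

module Branching {c ℓ : Level} (R : CommutativeRing c ℓ) where
  open CommutativeRing R renaming (_+_ to _⊕_; _*_ to _⊛_) hiding (zero)
  open import Relation.Binary.Reasoning.Setoid setoid
  open Sequences R using (_^_; ∑; ∑-cong; ∑-vanish; IsLinear)
  open Partitions
  open Arithmetic

  -- ISum V F = Σ_{ν interlacing V} F ν (|V| - |ν|), organised as nested sums row by row.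
  ISum : ∀ {k} → Vec ℕ (suc k) → (Vec ℕ k → ℕ → Carrier) → Carrier
  ISum (a ∷ []) F = F [] a
  ISum (a ∷ b ∷ w) F = ∑ (suc (a ∸ b)) (λ i → ISum (b ∷ w) (λ ν d → F ((b + i) ∷ ν) (((a ∸ b) ∸ i) + d)))

  ISum-cong : ∀ {k} (V : Vec ℕ (suc k)) → Part V → ∀ {F F'} →
    (∀ ν d → Interl V ν → F ν d ≈ F' ν d) → ISum V F ≈ ISum V F'
  ISum-cong (a ∷ []) _ h = h [] a tt
  ISum-cong (a ∷ b ∷ w) (b≤a , pV) h = ∑-cong (suc (a ∸ b)) (λ i i≤ → ISum-cong (b ∷ w) pV (λ ν d int →
    h ((b + i) ∷ ν) (((a ∸ b) ∸ i) + d) (ℕₚ.m≤m+n b i , within b≤a (ℕₚ.≤-pred i≤) , int)))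

  ISum-zero : ∀ {k} (V : Vec ℕ (suc k)) → ISum V (λ _ _ → 0#) ≈ 0#
  ISum-zero (a ∷ []) = refl
  ISum-zero (a ∷ b ∷ w) = ∑-vanish (suc (a ∸ b)) (λ i _ → ISum-zero (b ∷ w))

  ISum-comm : ∀ {I : Set} {Φ : (I → Carrier) → Carrier} → IsLinear Φ →
    ∀ {k} (V : Vec ℕ (suc k)) (F : I → Vec ℕ k → ℕ → Carrier) →
    Φ (λ i → ISum V (F i)) ≈ ISum V (λ ν d → Φ (λ i → F i ν d))
  ISum-comm lin (a ∷ []) F = refl
  ISum-comm lin (a ∷ b ∷ w) F = trans (IsLinear.∑-comm lin (suc (a ∸ b))
      (λ j i → ISum (b ∷ w) (λ ν d → F i ((b + j) ∷ ν) (((a ∸ b) ∸ j) + d))))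
    (∑-cong (suc (a ∸ b)) (λ j _ → ISum-comm lin (b ∷ w) (λ i ν d → F i ((b + j) ∷ ν) (((a ∸ b) ∸ j) + d))))

  sumL-++ : ∀ {A : Set} (f : A → Carrier) L L' → sumL R (map f (L ++ L')) ≈ sumL R (map f L) ⊕ sumL R (map f L')
  sumL-++ f [] L' = sym (+-identityˡ _)
  sumL-++ f (a ∷ L) L' = trans (+-congˡ (sumL-++ f L L')) (sym (+-assoc _ _ _))

  sumL-concatMap : ∀ {A B : Set} (f : B → Carrier) (g : A → List B) L →
    sumL R (map f (concatMap g L)) ≈ sumL R (map (λ a → sumL R (map f (g a))) L)
  sumL-concatMap f g [] = refl
  sumL-concatMap f g (a ∷ L) = trans (sumL-++ f (g a) (concatMap g L)) (+-congˡ (sumL-concatMap f g L))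

  sumL-range : ∀ n (h : ℕ → Carrier) b → sumL R (map h (map (b +_) (upTo n))) ≈ ∑ n (λ i → h (b + i))
  sumL-range n h b = go n id
    where
    go : ∀ n (g : ℕ → ℕ) → sumL R (map h (map (b +_) (applyUpTo g n))) ≈ ∑ n (λ i → h (b + g i))
    go zero g = refl
    go (suc n) g = +-congˡ (go n (g ∘ suc))

  sumL-cong : ∀ {A : Set} (L : List A) {f g} → All (λ a → f a ≈ g a) L → sumL R (map f L) ≈ sumL R (map g L)
  sumL-cong [] [] = refl
  sumL-cong (a ∷ L) (e ∷ es) = +-cong e (sumL-cong L es)

  interl-size : ∀ {k} (V : Vec ℕ (suc k)) → Part V → All (λ ν → sumV ν ℕ.≤ sumV V) (interl V)
  interl-size (a ∷ []) _ = z≤n ∷ []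
  interl-size (a ∷ b ∷ w) (b≤a , pV) =
    Allₚ.concat⁺ (Allₚ.map⁺ (Allₚ.map⁺ (Allₚ.applyUpTo⁺₁ id (suc (a ∸ b)) (λ {i} i≤ →
      Allₚ.map⁺ (All.map (ℕₚ.+-mono-≤ (within b≤a (ℕₚ.≤-pred i≤))) (interl-size (b ∷ w) pV))))))

  interl-sum : ∀ {k} (V : Vec ℕ (suc k)) (F : Vec ℕ k → ℕ → Carrier) → Part V →
    sumL R (map (λ ν → F ν (sumV V ∸ sumV ν)) (interl V)) ≈ ISum V F
  interl-sum (a ∷ []) F _ = trans (+-identityʳ _) (reflexive (≡.cong (F []) (ℕₚ.+-identityʳ a)))
  interl-sum (a ∷ b ∷ w) F (b≤a , pV) = begin
    sumL R (map G (concatMap (λ c' → map (c' ∷_) (interl (b ∷ w))) (range b a)))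
      ≈⟨ sumL-concatMap G (λ c' → map (c' ∷_) (interl (b ∷ w))) (range b a) ⟩
    sumL R (map (λ c' → sumL R (map G (map (c' ∷_) (interl (b ∷ w))))) (range b a))
      ≈⟨ sumL-range (suc (a ∸ b)) _ b ⟩
    ∑ (suc (a ∸ b)) (λ i → sumL R (map G (map ((b + i) ∷_) (interl (b ∷ w)))))
      ≈⟨ ∑-cong (suc (a ∸ b)) (λ i i≤ → row i (ℕₚ.≤-pred i≤)) ⟩
    ISum (a ∷ b ∷ w) F
      ∎
    where
    G : Vec ℕ _ → Carrier
    G ν = F ν (sumV (a ∷ b ∷ w) ∸ sumV ν)
    row : ∀ i → i ℕ.≤ a ∸ b → sumL R (map G (map ((b + i) ∷_) (interl (b ∷ w))))
                             ≈ ISum (b ∷ w) (λ ν d → F ((b + i) ∷ ν) (((a ∸ b) ∸ i) + d))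
    row i i≤ = begin
      sumL R (map G (map ((b + i) ∷_) (interl (b ∷ w))))
        ≡⟨ ≡.cong (sumL R) (Listₚ.map-∘ (interl (b ∷ w))) ⟨
      sumL R (map (G ∘ ((b + i) ∷_)) (interl (b ∷ w)))
        ≈⟨ sumL-cong (interl (b ∷ w)) (All.map (λ {ν} ν≤ → reflexive (≡.cong (F ((b + i) ∷ ν))
             (split-exponent a (sumV (b ∷ w)) b i (sumV ν) (within b≤a i≤) ν≤)))
             (interl-size (b ∷ w) pV)) ⟩
      sumL R (map (λ ν → F ((b + i) ∷ ν) (((a ∸ b) ∸ i) + (sumV (b ∷ w) ∸ sumV ν))) (interl (b ∷ w)))
        ≈⟨ interl-sum (b ∷ w) _ pV ⟩
      ISum (b ∷ w) (λ ν d → F ((b + i) ∷ ν) (((a ∸ b) ∸ i) + d))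
        ∎

  schur-branching : ∀ k (V : Vec ℕ (suc k)) (x : Fin (suc k) → Carrier) → Part V →
    schur R (suc k) V x ≈ ISum V (λ ν d → x (fromℕ k) ^ d ⊛ schur R k ν (x ∘ inject₁))
  schur-branching k V x = interl-sum V (λ ν d → x (fromℕ k) ^ d ⊛ schur R k ν (x ∘ inject₁))

module Recurrence {c ℓ : Level} (R : CommutativeRing c ℓ) (m : ℕ) where
  open CommutativeRing R renaming (_+_ to _⊕_; _*_ to _⊛_) hiding (zero)
  open import Relation.Binary.Reasoning.Setoid setoid
  open Sequences R
  open Roots R
  open Partitions
  open Rectangles m
  open Branching R
  open Arithmetic

  window : Carrier → (b top : ℕ) → (ℕ → ℕ → Carrier) → Seq
  window z b top H u = ∑ (suc ((top + u * m) ∸ b)) (λ i → z ^ (((top + u * m) ∸ b) ∸ i) ⊛ H u (b + i))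

  window-rev : Carrier → (b top : ℕ) → (ℕ → ℕ → Carrier) → Seq
  window-rev z b top H u = ∑ (suc ((top + u * m) ∸ b)) (λ i → z ^ i ⊛ H u ((top + u * m) ∸ i))

  window-reverse : ∀ z b top → b ℕ.≤ top → ∀ H u → window z b top H u ≈ window-rev z b top H u
  window-reverse z b top b≤top H u =
    trans (∑-reverse (suc N) (λ i → z ^ (N ∸ i) ⊛ H u (b + i))) (∑-cong (suc N) (λ i i≤ → term i (ℕₚ.≤-pred i≤)))
    where
    C : ℕ
    C = top + u * m
    N : ℕ
    N = C ∸ b
    term : ∀ i → i ℕ.≤ N → z ^ (N ∸ (N ∸ i)) ⊛ H u (b + (N ∸ i)) ≈ z ^ i ⊛ H u (C ∸ i)
    term i i≤N = reflexive (≡.cong₂ (λ e j → z ^ e ⊛ H u j) (ℕₚ.m∸[m∸n]≡n i≤N)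
      (from-top (ℕₚ.≤-trans b≤top (ℕₚ.m≤m+n top (u * m))) i≤N))

  -- The k m entries entering at the bottom of the window when time moves from s to s + k.
  window-new : Carrier → (b : ℕ) → (ℕ → ℕ → Carrier) → ℕ → ℕ → Carrier
  window-new z b H s k = ∑ (k * m) (λ i → z ^ i ⊛ H (s + k) (b + (k * m ∸ suc i)))

  window-rev-shift : ∀ z b top → b ℕ.≤ top → ∀ H s k →
    window-rev z b top H (s + k)
      ≈ ∑ (suc ((top + s * m) ∸ b)) (λ i → z ^ i ⊛ H (s + k) ((top + (s + k) * m) ∸ i))
        ⊕ z ^ suc ((top + s * m) ∸ b) ⊛ window-new z b H s k
  window-rev-shift z b top b≤top H s k = begin
    ∑ (suc ((top + (s + k) * m) ∸ b)) f
      ≡⟨ ≡.cong (λ n → ∑ (suc n) f) grow ⟩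
    ∑ (suc N + k * m) f
      ≈⟨ ∑-split (suc N) (k * m) f ⟩
    ∑ (suc N) f ⊕ ∑ (k * m) (λ i → f (suc N + i))
      ≈⟨ +-congˡ (∑-cong (k * m) new) ⟩
    ∑ (suc N) f ⊕ ∑ (k * m) (λ i → z ^ suc N ⊛ (z ^ i ⊛ H (s + k) (b + (k * m ∸ suc i))))
      ≈⟨ +-congˡ (IsLinear.*-hom (∑-linear (k * m)) _ _) ⟩
    ∑ (suc N) f ⊕ z ^ suc N ⊛ window-new z b H s k
      ∎
    where
    N : ℕ
    N = (top + s * m) ∸ b
    f : ℕ → Carrier
    f i = z ^ i ⊛ H (s + k) ((top + (s + k) * m) ∸ i)
    b≤C : b ℕ.≤ top + s * m
    b≤C = ℕₚ.≤-trans b≤top (ℕₚ.m≤m+n top (s * m))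
    grow : (top + (s + k) * m) ∸ b ≡ N + k * m
    grow = ≡.trans (≡.cong (_∸ b) (ray-step top s k m)) (ℕₚ.+-∸-comm (k * m) b≤C)
    index : ∀ i → i < k * m → (top + (s + k) * m) ∸ (suc N + i) ≡ b + (k * m ∸ suc i)
    index i i< = ≡.trans (≡.cong (_∸ (suc N + i))
                   (≡.trans (ray-step top s k m) (≡.cong (_+ k * m) (≡.sym (ℕₚ.m+[n∸m]≡n b≤C)))))
                 (new-bottom b N (k * m) i i<)
    new : ∀ i → i < k * m → f (suc N + i) ≈ z ^ suc N ⊛ (z ^ i ⊛ H (s + k) (b + (k * m ∸ suc i)))
    new i i< = trans (*-cong (^-+ z (suc N) i) (reflexive (≡.cong (H (s + k)) (index i i<)))) (*-assoc _ _ _)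

  window-top : ∀ z b top → b ℕ.≤ top → ∀ H q →
    (∀ s i → i ℕ.≤ (top + s * m) ∸ b → recLHS R q (λ k → H (s + k) ((top + (s + k) * m) ∸ i)) 0 ≈ 0#) →
    ∀ s → recLHS R q (window-rev z b top H) s
            ≈ z ^ suc ((top + s * m) ∸ b) ⊛ recLHS R q (window-new z b H s) 0
  window-top z b top b≤top H q top-ann s = begin
    recLHS R q (window-rev z b top H) s
      ≡⟨ ≡.cong (recLHS R q (window-rev z b top H)) (ℕₚ.+-identityʳ s) ⟨
    recLHS R q (window-rev z b top H) (s + 0)
      ≈⟨ recLHS-shift q _ s 0 ⟩
    recLHS R q (λ k → window-rev z b top H (s + k)) 0
      ≈⟨ recLHS-cong q 0 (window-rev-shift z b top b≤top H s) ⟩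
    recLHS R q (λ k → old k ⊕ z ^ suc N ⊛ window-new z b H s k) 0
      ≈⟨ +-hom _ _ ⟩
    recLHS R q old 0 ⊕ recLHS R q (λ k → z ^ suc N ⊛ window-new z b H s k) 0
      ≈⟨ +-cong old-vanishes (*-hom _ _) ⟩
    0# ⊕ z ^ suc N ⊛ recLHS R q (window-new z b H s) 0
      ≈⟨ +-identityˡ _ ⟩
    z ^ suc N ⊛ recLHS R q (window-new z b H s) 0
      ∎
    where
    open IsLinear (recLHS-linear q 0)
    N : ℕ
    N = (top + s * m) ∸ b
    old : ℕ → Carrier
    old k = ∑ (suc N) (λ i → z ^ i ⊛ H (s + k) ((top + (s + k) * m) ∸ i))
    old-vanishes : recLHS R q old 0 ≈ 0#
    old-vanishes = trans (∑-comm (suc N) (λ i k → z ^ i ⊛ H (s + k) ((top + (s + k) * m) ∸ i)))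
      (∑-vanish (suc N) (λ i i≤ →
        trans (*-hom (z ^ i) _) (trans (*-congˡ (top-ann s i (ℕₚ.≤-pred i≤))) (zeroʳ _))))

  window-new-ann : ∀ z b H q ys → (∀ k j → b ℕ.≤ j → j < b + k * m → Ann ys (λ u → H (k + u) j)) →
    Ann ys (λ s → recLHS R q (window-new z b H s) 0)
  window-new-ann z b H q ys bottom-ann t = begin
    Op ys (λ s → recLHS R q (window-new z b H s) 0) t
      ≈⟨ IsLinear.recLHS-comm (Op-linear ys t) q (λ k s → window-new z b H s k) 0 ⟩
    recLHS R q (λ k → Op ys (λ s → window-new z b H s k) t) 0
      ≈⟨ IsLinear.vanish (recLHS-linear q 0) column ⟩
    0#
      ∎
    where
    entry : ∀ k i → i < k * m → Op ys (λ s → H (s + k) (b + (k * m ∸ suc i))) t ≈ 0#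
    entry k i i< = trans (Op-cong ys t (λ s → reflexive (≡.cong (λ v → H v j) (ℕₚ.+-comm s k))))
      (bottom-ann k j (ℕₚ.m≤m+n b _) (ℕₚ.+-monoʳ-< b (ℕₚ.∸-monoʳ-< (s≤s z≤n) i<)) t)
      where
      j : ℕ
      j = b + (k * m ∸ suc i)
    column : ∀ k → Op ys (λ s → window-new z b H s k) t ≈ 0#
    column k = trans (IsLinear.∑-comm (Op-linear ys t) (k * m) _) (∑-vanish (k * m) (λ i i< →
      trans (IsLinear.*-hom (Op-linear ys t) (z ^ i) _) (trans (*-congˡ (entry k i i<)) (zeroʳ _))))

  window-ann : ∀ z b top → b ℕ.≤ top → (H : ℕ → ℕ → Carrier) (ysA ysB : List Carrier) →
    (∀ s i → i ℕ.≤ (top + s * m) ∸ b →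
       recLHS R (prodLin R ysB) (λ k → H (s + k) ((top + (s + k) * m) ∸ i)) 0 ≈ 0#) →
    (∀ k j → b ℕ.≤ j → j < b + k * m → Ann ysA (λ u → H (k + u) j)) →
    Ann (ysB ++ map ((z ^ m) ⊛_) ysA) (window z b top H)
  window-ann z b top b≤top H ysA ysB top-ann bottom-ann t = begin
    Op (ysB ++ ysA′) (window z b top H) t
      ≡⟨ Op-++ ysB ysA′ _ t ⟩
    Op ysA′ (Op ysB (window z b top H)) t
      ≈⟨ Op-cong ysA′ t (λ s → trans (sym (recLHS-prodLin ysB _ s)) (reduce s)) ⟩
    Op ysA′ (λ s → C ⊛ ((z ^ m) ^ s ⊛ W s)) t
      ≈⟨ Ann-scale ysA′ C (Ann-twist ysA (z ^ m) (window-new-ann z b H q ysA bottom-ann)) t ⟩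
    0#
      ∎
    where
    ysA′ : List Carrier
    ysA′ = map ((z ^ m) ⊛_) ysA
    q : List Carrier
    q = prodLin R ysB
    W : Seq
    W s = recLHS R q (window-new z b H s) 0
    C : Carrier
    C = z ^ suc (top ∸ b)
    power : ∀ s → z ^ suc ((top + s * m) ∸ b) ≈ C ⊛ (z ^ m) ^ s
    power s = begin
      z ^ suc ((top + s * m) ∸ b)   ≡⟨ ≡.cong (λ e → z ^ suc e) (ℕₚ.+-∸-comm (s * m) b≤top) ⟩
      z ^ (suc (top ∸ b) + s * m)   ≈⟨ ^-+ z (suc (top ∸ b)) (s * m) ⟩
      C ⊛ z ^ (s * m)               ≈⟨ *-congˡ (^-* z m s) ⟨
      C ⊛ (z ^ m) ^ s               ∎
    reduce : ∀ s → recLHS R q (window z b top H) s ≈ C ⊛ ((z ^ m) ^ s ⊛ W s)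
    reduce s = begin
      recLHS R q (window z b top H) s       ≈⟨ recLHS-cong q s (window-reverse z b top b≤top H) ⟩
      recLHS R q (window-rev z b top H) s   ≈⟨ window-top z b top b≤top H q top-ann s ⟩
      z ^ suc ((top + s * m) ∸ b) ⊛ W s     ≈⟨ *-congʳ (power s) ⟩
      (C ⊛ (z ^ m) ^ s) ⊛ W s               ≈⟨ *-assoc _ _ _ ⟩
      C ⊛ ((z ^ m) ^ s ⊛ W s)               ∎

  Family : ℕ → Set c
  Family k = ℕ → Vec ℕ k → ℕ → Carrier

  -- The first r rows are peeled off one at a time;
  -- the last shifted row contributes a window sum.
  module Shape (z : Carrier) (ysA ysB : List Carrier) where

    -- the roots involving z: z^m times the roots of one size less
    ysA′ : List Carrier
    ysA′ = map ((z ^ m) ⊛_) ysA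

    Y : List Carrier
    Y = ysB ++ ysA′

    PowerOf : ∀ {k} → Family k → Set ℓ
    PowerOf G = ∀ u ν e d → G u ν (e + d) ≈ z ^ e ⊛ G u ν d

    Admissible : ∀ {k} → (ℕ → Vec ℕ k → Set) → ℕ → Set
    Admissible Pr a = ∀ s β → Part β → headLe β (a + s * m) → Pr s β

    AnnRays : ∀ {k} → List Carrier → Vec ℕ k → Family k → (ℕ → Vec ℕ k → Set) → Set ℓ
    AnnRays ys ρ G Pr = ∀ s β d → Pr s β → Ann ys (λ u → G (s + u) (addScaled β u ρ) d)

    PowerOf-step : ∀ {k} {G : Family (suc k)} → PowerOf G → ∀ p E →
      PowerOf (λ u ν d → G u ((p + u * m) ∷ ν) (E + d))
    PowerOf-step {G = G} pow p E u ν e d =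
      trans (reflexive (≡.cong (G u ((p + u * m) ∷ ν)) (+-left-comm E e d))) (pow u _ e (E + d))

    Admissible-step : ∀ {k} {Pr : ℕ → Vec ℕ (suc k) → Set} {a} → Admissible Pr a → ∀ {p b} →
      b ℕ.≤ p → p ℕ.≤ a → Admissible (λ s β → Pr s ((p + s * m) ∷ β)) b
    Admissible-step adm b≤p p≤a s β pβ h =
      adm s _ (headLe-mono β (ℕₚ.+-monoˡ-≤ (s * m) b≤p) h , pβ) (ℕₚ.+-monoˡ-≤ (s * m) p≤a)

    AnnRays-step : ∀ {k} ys (ρ : Vec ℕ k) G Pr → AnnRays ys (m ∷ ρ) G Pr → ∀ p E →
      AnnRays ys ρ (λ u ν d → G u ((p + u * m) ∷ ν) (E + d)) (λ s β → Pr s ((p + s * m) ∷ β))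
    AnnRays-step ys ρ G Pr ann p E s β d pr = Ann-cong ys
      (λ u → reflexive (≡.cong (λ j → G (s + u) (j ∷ addScaled β u ρ) (E + d)) (ray-step p s u m)))
      (ann s ((p + s * m) ∷ β) (E + d) pr)

    shape-single : ∀ a (G : Family 0) Pr → PowerOf G → Admissible Pr a → AnnRays ysA [] G Pr →
      Ann Y (λ u → G u [] (a + u * m))
    shape-single a G Pr pow adm annA = Ann-++ ysB ysA′ (Ann-cong ysA′ twisted
      (Ann-scale ysA′ (z ^ a) (Ann-twist ysA (z ^ m) (annA 0 [] 0 (adm 0 [] tt tt)))))
      where
      twisted : ∀ u → G u [] (a + u * m) ≈ z ^ a ⊛ ((z ^ m) ^ u ⊛ G u [] 0)
      twisted u = begin
        G u [] (a + u * m)                ≡⟨ ≡.cong (G u []) (ℕₚ.+-identityʳ (a + u * m)) ⟨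
        G u [] ((a + u * m) + 0)          ≈⟨ pow u [] (a + u * m) 0 ⟩
        z ^ (a + u * m) ⊛ G u [] 0        ≈⟨ *-congʳ (trans (^-+ z a (u * m)) (*-congˡ (sym (^-* z m u)))) ⟩
        (z ^ a ⊛ (z ^ m) ^ u) ⊛ G u [] 0  ≈⟨ *-assoc _ _ _ ⟩
        z ^ a ⊛ ((z ^ m) ^ u ⊛ G u [] 0)  ∎

    -- For a fixed lower pattern δ below b, the columns of the window anchored at the top are
    -- points of rays of the rectangle with one row, hence killed by ysB ...
    window-top-hyp : ∀ {k} a b (G : Family (suc k)) (Pr : ℕ → Vec ℕ (suc k) → Set) → b ℕ.≤ a →
      Admissible Pr a → AnnRays ysB (rect (suc k) 1) G Pr → ∀ δ d → headLe δ b → Part δ →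
      ∀ s i → i ℕ.≤ (a + s * m) ∸ b →
      recLHS R (prodLin R ysB) (λ k → G (s + k) (((a + (s + k) * m) ∸ i) ∷ δ) d) 0 ≈ 0#
    window-top-hyp a b G Pr b≤a adm annB δ d hδ pδ s i i≤ =
      trans (recLHS-prodLin ysB _ 0) (Ann-cong ysB on-ray (annB s (((a + s * m) ∸ i) ∷ δ) d admissible) 0)
      where
      b≤C : b ℕ.≤ a + s * m
      b≤C = ℕₚ.≤-trans b≤a (ℕₚ.m≤m+n a (s * m))
      admissible : Pr s (((a + s * m) ∸ i) ∷ δ)
      admissible = adm s _ (headLe-mono δ (below-top b≤C i≤) hδ , pδ) (ℕₚ.m∸n≤m (a + s * m) i)
      on-ray : ∀ u → G (s + u) (((a + (s + u) * m) ∸ i) ∷ δ) d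
                   ≈ G (s + u) (addScaled (((a + s * m) ∸ i) ∷ δ) u (rect (suc _) 1)) d
      on-ray u = reflexive (≡.cong₂ (λ j ν → G (s + u) (j ∷ ν) d)
        (≡.sym (top-step a s u m (ℕₚ.≤-trans i≤ (ℕₚ.m∸n≤m (a + s * m) b)))) (≡.sym (addScaled-flat δ u)))

    -- ... and its rows anchored at the bottom are constant rays of the rectangle with no
    -- rows, hence killed by ysA.
    window-bottom-hyp : ∀ {k} a b (G : Family (suc k)) (Pr : ℕ → Vec ℕ (suc k) → Set) → b ℕ.≤ a →
      Admissible Pr a → AnnRays ysA (rect (suc k) 0) G Pr → ∀ δ d → headLe δ b → Part δ →
      ∀ k j → b ℕ.≤ j → j < b + k * m → Ann ysA (λ u → G (k + u) (j ∷ δ) d)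
    window-bottom-hyp a b G Pr b≤a adm annA δ d hδ pδ k j b≤j j< =
      Ann-cong ysA (λ u → reflexive (≡.cong (λ ν → G (k + u) ν d) (≡.sym (addScaled-flat (j ∷ δ) u))))
        (annA k (j ∷ δ) d (adm k (j ∷ δ) (headLe-mono δ b≤j hδ , pδ)
          (ℕₚ.≤-trans (ℕₚ.<⇒≤ j<) (ℕₚ.+-monoˡ-≤ (k * m) b≤a))))

    -- The last shifted row a + u m above the fixed rows b ∷ w: for each pattern δ of the lower
    -- rows, the entries of this row range over the window [b, a + u m].
    shape-lastRow : ∀ {k} a b (w : Vec ℕ k) → Part (a ∷ b ∷ w) →
      (G : Family (suc k)) (Pr : ℕ → Vec ℕ (suc k) → Set) → PowerOf G → Admissible Pr a →
      AnnRays ysB (rect (suc k) 1) G Pr → AnnRays ysA (rect (suc k) 0) G Pr →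
      Ann Y (λ u → ISum ((a + u * m) ∷ b ∷ w) (G u))
    shape-lastRow a b w (b≤a , pw) G Pr pow adm annB annA t = begin
      Op Y (λ u → ISum ((a + u * m) ∷ b ∷ w) (G u)) t
        ≈⟨ Op-cong Y t (λ u → ISum-comm (∑-linear (suc (N u))) (b ∷ w) (F u)) ⟩
      Op Y (λ u → ISum (b ∷ w) (λ δ d → ∑ (suc (N u)) (λ i → F u i δ d))) t
        ≈⟨ ISum-comm (Op-linear Y t) (b ∷ w) (λ u δ d → ∑ (suc (N u)) (λ i → F u i δ d)) ⟩
      ISum (b ∷ w) (λ δ d → Op Y (λ u → ∑ (suc (N u)) (λ i → F u i δ d)) t)
        ≈⟨ ISum-cong (b ∷ w) pw (λ δ d int → column δ d int t) ⟩
      ISum (b ∷ w) (λ _ _ → 0#)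
        ≈⟨ ISum-zero (b ∷ w) ⟩
      0#
        ∎
      where
      N : ℕ → ℕ
      N u = (a + u * m) ∸ b
      F : ℕ → ℕ → Vec ℕ _ → ℕ → Carrier
      F u i δ d = G u ((b + i) ∷ δ) ((N u ∸ i) + d)
      column : ∀ δ d → Interl (b ∷ w) δ → Ann Y (λ u → ∑ (suc (N u)) (λ i → F u i δ d))
      column δ d int = Ann-cong Y (λ u → ∑-cong (suc (N u)) (λ i _ → pow u ((b + i) ∷ δ) (N u ∸ i) d))
        (window-ann z b a b≤a (λ u j → G u (j ∷ δ) d) ysA ysB
          (window-top-hyp a b G Pr b≤a adm annB δ d hδ pδ)
          (window-bottom-hyp a b G Pr b≤a adm annA δ d hδ pδ))
        where
        hδ : headLe δ b
        hδ = interl-head (b ∷ w) δ int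
        pδ : Part δ
        pδ = interl-part (b ∷ w) δ pw int

    shape : ∀ k r → r ℕ.≤ k → (a : ℕ) (rest : Vec ℕ k) → Part (a ∷ rest) →
      (G : Family k) (Pr : ℕ → Vec ℕ k → Set) → PowerOf G → Admissible Pr a →
      (suc r ℕ.≤ k → AnnRays ysB (rect k (suc r)) G Pr) → AnnRays ysA (rect k r) G Pr →
      Ann Y (λ u → ISum (addScaled (a ∷ rest) u (rect (suc k) (suc r))) (G u))
    shape zero zero _ a [] _ G Pr pow adm _ annA = shape-single a G Pr pow adm annA
    shape (suc k) zero _ a (b ∷ w) pa G Pr pow adm annB annA =
      Ann-cong Y (λ u → reflexive (≡.cong (λ v → ISum ((a + u * m) ∷ v) (G u)) (addScaled-flat (b ∷ w) u)))
        (shape-lastRow a b w pa G Pr pow adm (annB (s≤s z≤n)) annA)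
    shape (suc k) (suc r) (s≤s r≤k) a (b ∷ w) (b≤a , pw) G Pr pow adm annB annA t = begin
      Op Y (λ u → ISum (V u) (G u)) t
        ≈⟨ Op-cong Y t peel ⟩
      Op Y (λ u → ∑ (suc (a ∸ b)) (λ i → ISum (V′ u) (G′ i u))) t
        ≈⟨ IsLinear.∑-comm (Op-linear Y t) (suc (a ∸ b)) (λ i u → ISum (V′ u) (G′ i u)) ⟩
      ∑ (suc (a ∸ b)) (λ i → Op Y (λ u → ISum (V′ u) (G′ i u)) t)
        ≈⟨ ∑-vanish (suc (a ∸ b)) (λ i i≤ → rows-below i (ℕₚ.≤-pred i≤) t) ⟩
      0#
        ∎
      where
      V : ℕ → Vec ℕ (suc (suc k))
      V u = addScaled (a ∷ b ∷ w) u (rect (suc (suc k)) (suc (suc r)))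
      V′ : ℕ → Vec ℕ (suc k)
      V′ u = addScaled (b ∷ w) u (rect (suc k) (suc r))
      -- the first row of an interlacing pattern sits at (b + i) + u m with 0 ≤ i ≤ a - b
      G′ : ℕ → Family k
      G′ i u ν d = G u (((b + i) + u * m) ∷ ν) (((a ∸ b) ∸ i) + d)
      peel : ∀ u → ISum (V u) (G u) ≈ ∑ (suc (a ∸ b)) (λ i → ISum (V′ u) (G′ i u))
      peel u = trans (reflexive (≡.cong (λ D → ∑ (suc D) (λ i → ISum (V′ u)
                        (λ ν d → G u (((b + u * m) + i) ∷ ν) ((D ∸ i) + d)))) (gap-step a b (u * m))))
        (∑-cong (suc (a ∸ b)) (λ i _ →
          ISum-cong (V′ u) (Part-addScaled (b ∷ w) _ u pw (Part-rect (suc k) (suc r))) (λ ν d _ →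
            reflexive (≡.cong (λ j → G u (j ∷ ν) (((a ∸ b) ∸ i) + d)) (+-right-comm b (u * m) i)))))
      rows-below : ∀ i → i ℕ.≤ a ∸ b → Ann Y (λ u → ISum (V′ u) (G′ i u))
      rows-below i i≤ = shape k r r≤k b w pw (G′ i) (λ s β → Pr s (((b + i) + s * m) ∷ β))
        (PowerOf-step pow (b + i) ((a ∸ b) ∸ i))
        (Admissible-step adm (ℕₚ.m≤m+n b i) (within b≤a i≤))
        (λ r<k → AnnRays-step ysB (rect k (suc r)) G Pr (annB (s≤s r<k)) (b + i) ((a ∸ b) ∸ i))
        (AnnRays-step ysA (rect k r) G Pr annA (b + i) ((a ∸ b) ∸ i))

  schur-ann : ∀ k r → r ℕ.≤ k → (x : Fin k → Carrier) (β : Vec ℕ k) → Part β →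
    Ann (roots k r m x) (λ u → schur R k (addScaled β u (rect k r)) x)
  schur-ann k zero _ x β _ t = begin
    f (suc t) ⊕ (- (1# ^ m)) ⊛ f t   ≈⟨ +-cong (constant (suc t)) (*-cong (-‿cong (1^ m)) (constant t)) ⟩
    s ⊕ (- 1#) ⊛ s                   ≈⟨ +-congˡ (RingProperties.-1*x≈-x ring s) ⟩
    s ⊕ (- s)                        ≈⟨ -‿inverseʳ s ⟩
    0#                               ∎
    where
    f : Seq
    f u = schur R k (addScaled β u (rect k zero)) x
    s : Carrier
    s = schur R k β x
    constant : ∀ u → f u ≈ s
    constant u = reflexive (≡.cong (λ v → schur R k v x) (addScaled-flat β u))
  schur-ann (suc k) (suc r) (s≤s r≤k) x (a ∷ w) pβ t = begin
    Op (roots (suc k) (suc r) m x) f t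
      ≈⟨ Op-↭ (roots-last k r m x) f t ⟩
    Op Y f t
      ≈⟨ Op-cong Y t (λ u → schur-branching k _ x (Part-addScaled (a ∷ w) _ u pβ (Part-rect (suc k) (suc r)))) ⟩
    Op Y (λ u → ISum (addScaled (a ∷ w) u (rect (suc k) (suc r))) (G u)) t
      ≈⟨ shape k r r≤k a w pβ G (λ _ β → Part β) power (λ _ _ pβ′ _ → pβ′) annB annA t ⟩
    0#
      ∎
    where
    z : Carrier
    z = x (fromℕ k)
    x′ : Fin k → Carrier
    x′ = x ∘ inject₁
    open Shape z (roots k r m x′) (roots k (suc r) m x′)
    f : Seq
    f u = schur R (suc k) (addScaled (a ∷ w) u (rect (suc k) (suc r))) x
    G : Family k
    G u ν d = z ^ d ⊛ schur R k ν x′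
    power : PowerOf G
    power u ν e d = trans (*-congʳ (^-+ z e d)) (*-assoc _ _ _)
    annB : suc r ℕ.≤ k → AnnRays (roots k (suc r) m x′) (rect k (suc r)) G (λ _ β → Part β)
    annB r<k s β d pβ′ = Ann-scale (roots k (suc r) m x′) (z ^ d) (schur-ann k (suc r) r<k x′ β pβ′)
    annA : AnnRays (roots k r m x′) (rect k r) G (λ _ β → Part β)
    annA s β d pβ′ = Ann-scale (roots k r m x′) (z ^ d) (schur-ann k r r≤k x′ β pβ′)

-- The theorem, with L = 0.  The characteristic polynomial is ∏ (t - y) over roots n r m x, so its action is
-- that of the difference operators, which annihilate the sequence by schur-ann.
theorem5p1 : ∀ {c ℓ : Level} (R : CommutativeRing c ℓ)
    (n m r : ℕ) → 1 Data.Nat.≤ n → 1 Data.Nat.≤ m → 1 Data.Nat.≤ r → r Data.Nat.≤ n →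
    (λ' : Vec ℕ n) →
    (∀ (i j : Fin n) → i Data.Fin.≤ j → lookup λ' j Data.Nat.≤ lookup λ' i) →
    (∀ (i : Fin n) → r Data.Nat.≤ toℕ i → lookup λ' i ≡ 0) →
    (x : Fin n → CommutativeRing.Carrier R) →
    ∃ λ L → SatisfiesRecFrom R (charPoly R n r m x)
      (λ k → schur R n (addScaled λ' k (rectangle n r m)) x) L
theorem5p1 R n m r _ _ _ r≤n λ' decreasing _ x = 0 , λ k _ → begin
  recLHS R (charPoly R n r m x) f k                         ≈⟨ recLHS-prodLin (roots n r m x) f k ⟩
  Op (roots n r m x) f k                                    ≈⟨ Op-cong (roots n r m x) k as-rect ⟩
  Op (roots n r m x) (λ u → schur R n (addScaled λ' u (rect n r)) x) k
                                                            ≈⟨ schur-ann n r r≤n x λ' (Part-of λ' decreasing) k ⟩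
  0#                                                        ∎
  where
  open CommutativeRing R using (_≈_; setoid; reflexive; 0#)
  open import Relation.Binary.Reasoning.Setoid setoid
  open Sequences R using (Op; Op-cong; recLHS-prodLin)
  open Roots R using (roots)
  open Partitions using (Part-of)
  open Rectangles m using (rect; rectangle≡rect)
  open Recurrence R m using (schur-ann)
  f : ℕ → CommutativeRing.Carrier R
  f u = schur R n (addScaled λ' u (rectangle n r m)) x
  as-rect : ∀ u → f u ≈ schur R n (addScaled λ' u (rect n r)) x
  as-rect u = reflexive (≡.cong (λ ρ → schur R n (addScaled λ' u ρ) x) (rectangle≡rect n r))
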